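{- Let $s\ge 1$ and $t\ge 2$ be integers and let $G\in\mathcal{G}_{s,t}$ with root $r$ (the vertex of $K_1$). Then $$\eta(G,r)=\begin{cases} t+2s+4, & s \text{ even},\\ t+2s+3, & s \text{ odd.}\end{cases}$$
   Context: All graphs are finite, simple and connected. A configuration $C$ on a graph $G$ is a function $C:V(G)\to\mathbb{Z}_{\ge 0}$ ($C(v)$ is the number of pebbles on $v$); its size is $\sum_{v}C(v)$. A pebbling move removes two pebbles from a vertex and places one pebble on an adjacent vertex. The Two-Player Pebbling Game on $G$ with root $r$ and starting configuration $C$ is played by Mover and Defender in rounds: in each round Mover makes a pebbling move and then Defender makes a pebbling move; each player must take their turn. If Mover pebbles from $u$ to $v$, Defender may not pebble from $v$ to $u$ in the same round. Mover wins if at any time the root has at least one pebble; Defender wins if the root has no pebble and there are no more pebbling moves. A winning strategy for a player is a rule choosing that player's moves as a function of the current position which guarantees that player wins. The rooted two-player pebbling number $\eta(G,r)$ is the minimum $m$ such that for every configuration of $m$ pebbles Mover has a winning strategy; if for arbitrarily large $m$ there is a configuration of size greater than $m$ on which Defender has a winning strategy, then $\eta(G,r)=\infty$. For integers $s,t\ge1$, $\mathcal{G}_{s,t}$ is the class of all graphs $(K_1\cup \overline{K_t})\vee H$, where $H$ is any graph on $s$ vertices, $\overline{K_t}$ is the edgeless graph on $t$ vertices, $\cup$ is disjoint union and $\vee$ is the join (add all edges between the two graphs). The root $r$ is the vertex of $K_1$; $S=V(H)$ and $T=V(\overline{K_t})$. Thus $r$ is adjacent exactly to the vertices of $S$, each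 vertex of $T$ is adjacent exactly to the vertices of $S$, $T$ is independent, and $S$ induces $H$. -}

module Defs where

open import Data.Nat using (ℕ; zero; suc; _+_; _∸_; _≤_; _<_)
open import Data.Nat.Properties using ()
open import Data.Fin using (Fin)
import Data.Fin as F
open import Data.Product using (Σ; ∃; _×_; _,_)
open import Relation.Nullary using (¬_; yes; no)
open import Relation.Binary.PropositionalEquality using (_≡_; refl; cong)
open import Relation.Binary.Definitions using (DecidableEquality)

module Pebbling {V : Set} (_≟_ : DecidableEquality V)
                (Adj : V → V → Set) (r : V) where

  Config : Set
  Config = V → ℕ

  move : Config → V → V → Config
  move C u v w with w ≟ u | w ≟ v
  ... | yes _ | yes _ = (C w ∸ 2) + 1
  ... | yes _ | no  _ = C w ∸ 2
  ... | no  _ | yes _ = C w + 1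
  ... | no  _ | no  _ = C w

  Legal : Config → V → V → Set
  Legal C u v = Adj u v × 2 ≤ C u

  mutual
    -- Mover has a winning strategy from C, Mover to move.
    data MoverWins : Config → Set where
      rootPebbled : ∀ {C} → 1 ≤ C r → MoverWins C
      play        : ∀ {C} u v → Legal C u v →
                    MoverWinsD (move C u v) u v → MoverWins C

    -- Mover has a winning strategy from C, Defender to move, after
    -- Mover's move u → v (so Defender may not play v → u).
    data MoverWinsD : Config → V → V → Set where
      rootPebbledD : ∀ {C u v} → 1 ≤ C r → MoverWinsD C u v
      respond      : ∀ {C u v} →
                     -- Defender has some legal move (else the game ends, Defender wins)
                     (Σ V λ a → Σ V λ b → Legal C a b × ¬ (a ≡ v × b ≡ u)) →
                     (∀ a b → Legal C a b → ¬ (a ≡ v × b ≡ u) →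
                        MoverWins (move C a b)) →
                     MoverWinsD C u v

  mutual
    data DefenderWins : Config → Set where
      allMoves : ∀ {C} → C r ≡ 0 →
                 (∀ u v → Legal C u v → DefenderWinsD (move C u v) u v) →
                 DefenderWins C

    data DefenderWinsD : Config → V → V → Set where
      stuck  : ∀ {C u v} → C r ≡ 0 →
               (∀ a b → Legal C a b → a ≡ v × b ≡ u) →
               DefenderWinsD C u v
      choose : ∀ {C u v} → C r ≡ 0 → ∀ a b → Legal C a b → ¬ (a ≡ v × b ≡ u) →
               DefenderWins (move C a b) → DefenderWinsD C u v

  EtaIs : (Config → ℕ) → ℕ → Set
  EtaIs size N =
    (∀ C → size C ≡ N → MoverWins C) ×
    (∀ m → m < N → Σ Config λ C → size C ≡ m × ¬ MoverWins C) ×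
    -- η is not ∞: Defender does not win on configurations of arbitrarily large size
    ¬ (∀ m → Σ Config λ C → m < size C × DefenderWins C)

-- The class 𝒢_{s,t}: (K₁ ∪ K̄_t) ∨ H, H a simple graph on s vertices.

record SimpleGraph (s : ℕ) : Set₁ where
  field
    E      : Fin s → Fin s → Set
    sym    : ∀ {i j} → E i j → E j i
    irrefl : ∀ {i} → ¬ E i i

data Vtx (s t : ℕ) : Set where
  root : Vtx s t
  sv   : Fin s → Vtx s t
  tv   : Fin t → Vtx s t

sv-inj : ∀ {s t} {i j : Fin s} → sv {s} {t} i ≡ sv j → i ≡ j
sv-inj refl = refl

tv-inj : ∀ {s t} {i j : Fin t} → tv {s} {t} i ≡ tv j → i ≡ j
tv-inj refl = refl

_≟V_ : ∀ {s t} → DecidableEquality (Vtx s t)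
root ≟V root = yes refl
root ≟V sv _ = no λ ()
root ≟V tv _ = no λ ()
sv _ ≟V root = no λ ()
sv i ≟V sv j with i F.≟ j
... | yes p = yes (cong sv p)
... | no ¬p = no λ q → ¬p (sv-inj q)
sv _ ≟V tv _ = no λ ()
tv _ ≟V root = no λ ()
tv _ ≟V sv _ = no λ ()
tv i ≟V tv j with i F.≟ j
... | yes p = yes (cong tv p)
... | no ¬p = no λ q → ¬p (tv-inj q)

data GAdj {s t : ℕ} (H : SimpleGraph s) : Vtx s t → Vtx s t → Set where
  r-s : ∀ i → GAdj H root (sv i)
  s-r : ∀ i → GAdj H (sv i) root
  t-s : ∀ j i → GAdj H (tv j) (sv i)
  s-t : ∀ i j → GAdj H (sv i) (tv j)
  s-s : ∀ i i' → SimpleGraph.E H i i' → GAdj H (sv i) (sv i')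

sumFin : (n : ℕ) → (Fin n → ℕ) → ℕ
sumFin zero    f = 0
sumFin (suc n) f = f F.zero + sumFin n (λ i → f (F.suc i))

size : ∀ {s t} → (Vtx s t → ℕ) → ℕ
size {s} {t} C = C root + sumFin s (λ i → C (sv i)) + sumFin t (λ j → C (tv j))

EtaG : ∀ {s t} → SimpleGraph s → ℕ → Set
EtaG {s} {t} H N = Pebbling.EtaIs (_≟V_ {s} {t}) (GAdj H) root size N

data Even : ℕ → Set where
  ev0 : Even 0
  ev2 : ∀ {n} → Even n → Even (suc (suc n))

module Submission where

-- Unless Mover wins at once (a pebble on r, or two on a vertex of S), the
-- position is *quiet*: r is empty and each vertex of S holds at most one
-- pebble.  Then every legal move takes two pebbles from T to S, and the game is
-- governed by the number e of holes (empty vertices of S) and the number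
-- p = Σ_{v ∈ T} ⌊C(v)/2⌋ of pairs on T.  Moving onto a hole (a *fill*) lowers
-- both by one; moving onto an occupied vertex must be answered by passing a
-- pebble on to T (a *bounce*), which opens a new hole.
--   * Mover wins from a quiet position if e is odd and p > e (win-odd), or if
--     e is even and p ≥ e + 3, or p ≥ e + 2 with all of T odd (win-even).
--   * Defender survives from a quiet position with p ≤ e for odd e, p ≤ e + 1
--     for even e, or p ≤ e + 2 for even e when a vertex of T is empty (defend).
-- Counting pebbles turns "at least t + 2s + c pebbles" into Mover's condition
-- (win-large), and explicit safe configurations realise every smaller size
-- (module Extremal).

open import Defs
open import Data.Nat using (ℕ; zero; suc; _+_; _*_; _∸_; _≤_; _<_; z≤n; s≤s; s≤s⁻¹; ⌊_/2⌋; _≤?_)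
open import Data.Nat.Properties
open import Data.Fin using (Fin)
import Data.Fin as F
open import Data.Product using (Σ; _×_; _,_; proj₁; proj₂)
open import Data.Sum using (_⊎_; inj₁; inj₂)
open import Data.Empty using (⊥; ⊥-elim)
open import Relation.Nullary using (¬_; Dec; yes; no)
open import Relation.Binary.PropositionalEquality
open import Relation.Binary.Definitions using (DecidableEquality)
import Data.Fin.Properties as FP
open import Data.Fin.Properties using (any?)
open import Data.Nat.Tactic.RingSolver using (solve-∀)
open import Algebra.Properties.CommutativeSemigroup +-commutativeSemigroup
  using (interchange; xy∙z≈zy∙x; xy∙z≈xz∙y)

Odd : ℕ → Set
Odd n = Even (suc n)

even-or-odd : ∀ n → Even n ⊎ Odd n
even-or-odd zero = inj₁ ev0
even-or-odd (suc zero) = inj₂ (ev2 ev0)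
even-or-odd (suc (suc n)) with even-or-odd n
... | inj₁ e = inj₁ (ev2 e)
... | inj₂ o = inj₂ (ev2 o)

¬even⇒odd : ∀ {n} → ¬ Even n → Odd n
¬even⇒odd {n} ¬e with even-or-odd n
... | inj₁ e = ⊥-elim (¬e e)
... | inj₂ o = o

even-+ : ∀ {a b} → Even a → Even b → Even (a + b)
even-+ ev0 eb = eb
even-+ (ev2 ea) eb = ev2 (even-+ ea eb)

even-pred₂ : ∀ {n} → Even (suc (suc n)) → Even n
even-pred₂ (ev2 e) = e

odd-∸2 : ∀ {n} → 2 ≤ n → Odd n → Odd (n ∸ 2)
odd-∸2 {suc (suc n)} _ o = even-pred₂ o
odd-∸2 {suc zero} (s≤s ()) _

even-cancelʳ : ∀ a {b} → Even b → Even (a + b) → Even a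
even-cancelʳ a ev0 e = subst Even (+-identityʳ a) e
even-cancelʳ a {suc (suc b)} (ev2 eb) e =
  even-cancelʳ a eb (even-pred₂ (subst Even (trans (+-suc a (suc b)) (cong suc (+-suc a b))) e))

even≥3 : ∀ {y} → Even y → 3 ≤ y → y ≡ 4 ⊎ 6 ≤ y
even≥3 ev0 ()
even≥3 (ev2 ev0) (s≤s (s≤s ()))
even≥3 (ev2 (ev2 ev0)) _ = inj₁ refl
even≥3 (ev2 (ev2 (ev2 _))) _ = inj₂ (s≤s (s≤s (s≤s (s≤s (s≤s (s≤s z≤n))))))

odd⇒≥1 : ∀ {n} → Odd n → 1 ≤ n
odd⇒≥1 {suc _} _ = s≤s z≤n

≤1-cases : ∀ {x} → x ≤ 1 → x ≡ 0 ⊎ x ≡ 1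
≤1-cases z≤n = inj₁ refl
≤1-cases (s≤s z≤n) = inj₂ refl

two≰one : ∀ {x} → x ≤ 1 → ¬ (2 ≤ x)
two≰one x≤1 2≤x = 1+n≰n (≤-trans 2≤x x≤1)

two≰zero : ∀ {x} → x ≡ 0 → ¬ (2 ≤ x)
two≰zero refl ()

half-∸2 : ∀ n → 2 ≤ n → ⌊ n /2⌋ ≡ suc ⌊ n ∸ 2 /2⌋
half-∸2 (suc (suc n)) _ = refl
half-∸2 (suc zero) (s≤s ())

half-suc≤ : ∀ n → ⌊ suc n /2⌋ ≤ suc ⌊ n /2⌋
half-suc≤ n = ⌊n/2⌋-mono (n≤1+n (suc n))

half-odd : ∀ {n} → Odd n → ⌊ suc n /2⌋ ≡ suc ⌊ n /2⌋
half-odd {suc zero} _ = refl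
half-odd {suc (suc n)} (ev2 o) = cong suc (half-odd o)

half≥1 : ∀ {n} → 1 ≤ ⌊ n /2⌋ → 2 ≤ n
half≥1 {suc (suc n)} _ = s≤s (s≤s z≤n)

≥2⇒half≥1 : ∀ {n} → 2 ≤ n → 1 ≤ ⌊ n /2⌋
≥2⇒half≥1 {suc (suc n)} _ = s≤s z≤n
≥2⇒half≥1 {suc zero} (s≤s ())

≤-double-half : ∀ n → n ≤ suc (⌊ n /2⌋ + ⌊ n /2⌋)
≤-double-half zero = z≤n
≤-double-half (suc zero) = s≤s z≤n
≤-double-half (suc (suc n)) =
  s≤s (s≤s (≤-trans (≤-double-half n) (≤-reflexive (sym (+-suc ⌊ n /2⌋ ⌊ n /2⌋)))))


double-half-odd : ∀ n → n ≡ suc (⌊ n /2⌋ + ⌊ n /2⌋) → Odd n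
double-half-odd (suc zero) _ = ev2 ev0
double-half-odd (suc (suc n)) eq =
  ev2 (double-half-odd n (suc-injective (suc-injective (trans eq (cong (λ x → suc (suc x)) (+-suc _ _))))))

half-≤ : ∀ {n} m → n ≤ suc (m + m) → ⌊ n /2⌋ ≤ m
half-≤ m h = ≤-trans (⌊n/2⌋-mono h) (≤-reflexive (sym (n≡⌈n+n/2⌉ m)))

double-≤ : ∀ {a b} → a + a ≤ b + b → a ≤ b
double-≤ {a} {b} h = subst₂ _≤_ (sym (n≡⌊n+n/2⌋ a)) (sym (n≡⌊n+n/2⌋ b)) (⌊n/2⌋-mono h)

double-< : ∀ {a b} → suc (a + a) ≤ b + b → suc a ≤ b
double-< {a} {b} h =
  subst₂ _≤_ (cong suc (sym (n≡⌊n+n/2⌋ a))) (sym (n≡⌈n+n/2⌉ b)) (⌈n/2⌉-mono h)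

-- The counting step of the upper bound, on plain numbers: σ pebbles on S
-- with e holes (σ + e = s), τ pebbles on T forming p pairs with slack δ
-- (τ + δ = 2p + t), and at least t + 2s + c pebbles in all.
budget : ∀ {s} t c σ e τ p δ → σ + e ≡ s → τ + δ ≡ p + p + t →
         t + 2 * s + c ≤ σ + τ → δ + (e + e) + (σ + c) ≤ p + p
budget t c σ e τ p δ refl slack enough = +-cancelˡ-≤ (σ + t) _ _ (begin
  σ + t + (δ + (e + e) + (σ + c))  ≡⟨ regroup σ e t c δ ⟩
  t + 2 * (σ + e) + c + δ          ≤⟨ +-monoˡ-≤ δ enough ⟩
  σ + τ + δ                        ≡⟨ trans (+-assoc σ τ δ) (cong (σ +_) slack) ⟩
  σ + (p + p + t)                  ≡⟨ regroup' σ p t ⟩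
  σ + t + (p + p)                  ∎)
  where
  open ≤-Reasoning
  regroup : ∀ σ e t c δ → σ + t + (δ + (e + e) + (σ + c)) ≡ t + 2 * (σ + e) + c + δ
  regroup = solve-∀
  regroup' : ∀ σ p t → σ + (p + p + t) ≡ σ + t + (p + p)
  regroup' = solve-∀

odd-budget : ∀ δ e y p → 3 ≤ y → δ + (e + e) + y ≤ p + p → suc e ≤ p
odd-budget δ e y p y≥3 enough = double-≤ (begin
  suc e + suc e      ≡⟨ cong suc (+-suc e e) ⟩
  2 + (e + e)        ≡⟨ +-comm 2 (e + e) ⟩
  e + e + 2          ≤⟨ +-mono-≤ (m≤n+m (e + e) δ) (≤-trans (n≤1+n 2) y≥3) ⟩
  δ + (e + e) + y    ≤⟨ enough ⟩
  _                  ∎)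
  where open ≤-Reasoning

doubling : ∀ k e → (k + e) + (k + e) ≡ e + e + (k + k)
doubling = solve-∀

even-budget : ∀ δ e y p → y ≡ 4 ⊎ 6 ≤ y → δ + (e + e) + y ≤ p + p →
              3 + e ≤ p ⊎ (δ ≡ 0 × 2 + e ≤ p)
even-budget δ e y p (inj₂ y≥6) enough = inj₁ (double-≤ (≤-trans (≤-reflexive (doubling 3 e))
  (≤-trans (+-mono-≤ (m≤n+m (e + e) δ) y≥6) enough)))
even-budget zero e .4 p (inj₁ refl) enough =
  inj₂ (refl , double-≤ (≤-trans (≤-reflexive (doubling 2 e)) enough))
even-budget (suc δ) e .4 p (inj₁ refl) enough = inj₁ (double-< (≤-trans (s≤s (≤-reflexive (doubling 2 e)))
  (≤-trans (s≤s (+-monoˡ-≤ 4 (m≤n+m (e + e) δ))) enough)))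

split : ∀ m k n → m ≤ n + k → Σ ℕ λ a → Σ ℕ λ r → r ≤ n × a + r ≡ m × a ≤ k
split m k n m≤n+k with m ≤? k
... | yes m≤k = m , 0 , z≤n , +-identityʳ m , m≤k
... | no m≰k = k , m ∸ k , m≤n+o⇒m∸n≤o m k (subst (m ≤_) (+-comm n k) m≤n+k) ,
               m+[n∸m]≡n (<⇒≤ (≰⇒> m≰k)) , ≤-refl

sumFin-cong : ∀ n {f g : Fin n → ℕ} → (∀ x → f x ≡ g x) → sumFin n f ≡ sumFin n g
sumFin-cong zero h = refl
sumFin-cong (suc n) h = cong₂ _+_ (h F.zero) (sumFin-cong n (λ x → h (F.suc x)))

sumFin-+ : ∀ n (f g : Fin n → ℕ) → sumFin n (λ x → f x + g x) ≡ sumFin n f + sumFin n g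
sumFin-+ zero f g = refl
sumFin-+ (suc n) f g = trans (cong (f F.zero + g F.zero +_) (sumFin-+ n _ _))
                             (interchange (f F.zero) (g F.zero) _ _)

sumFin-const : ∀ n k → sumFin n (λ _ → k) ≡ n * k
sumFin-const zero k = refl
sumFin-const (suc n) k = cong (k +_) (sumFin-const n k)

sumFin-zeros : ∀ n → sumFin n (λ _ → 0) ≡ 0
sumFin-zeros n = trans (sumFin-const n 0) (*-zeroʳ n)

sumFin-mono : ∀ n {f g : Fin n → ℕ} → (∀ x → f x ≤ g x) → sumFin n f ≤ sumFin n g
sumFin-mono zero h = z≤n
sumFin-mono (suc n) h = +-mono-≤ (h F.zero) (sumFin-mono n (λ x → h (F.suc x)))

sumFin-tight : ∀ n {f g : Fin n → ℕ} → (∀ x → f x ≤ g x) → sumFin n f ≡ sumFin n g →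
               ∀ x → f x ≡ g x
sumFin-tight (suc n) {f} {g} h eq = tight
  where
  rest≤ : sumFin n (λ x → f (F.suc x)) ≤ sumFin n (λ x → g (F.suc x))
  rest≤ = sumFin-mono n (λ x → h (F.suc x))
  head≡ : f F.zero ≡ g F.zero
  head≡ = ≤-antisym (h F.zero)
    (+-cancelʳ-≤ _ _ _ (≤-trans (≤-reflexive (sym eq)) (+-monoʳ-≤ (f F.zero) rest≤)))
  tight : ∀ x → f x ≡ g x
  tight F.zero = head≡
  tight (F.suc x) = sumFin-tight n (λ y → h (F.suc y)) (+-cancelˡ-≡ (f F.zero) _ _
    (trans eq (cong (_+ _) (sym head≡)))) x

sumFin-elem : ∀ n (f : Fin n → ℕ) x → f x ≤ sumFin n f
sumFin-elem (suc n) f F.zero = m≤m+n _ _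
sumFin-elem (suc n) f (F.suc x) = ≤-trans (sumFin-elem n _ x) (m≤n+m _ _)

sumFin-pos : ∀ n (f : Fin n → ℕ) → 1 ≤ sumFin n f → Σ (Fin n) λ x → 1 ≤ f x
sumFin-pos (suc n) f h with f F.zero in eq
... | suc _ = F.zero , subst (1 ≤_) (sym eq) (s≤s z≤n)
... | zero with sumFin-pos n (λ x → f (F.suc x)) h
...   | x , p = F.suc x , p

sumFin-point : ∀ n (f g : Fin n → ℕ) k → (∀ x → x ≢ k → f x ≡ g x) →
               sumFin n f + g k ≡ sumFin n g + f k
sumFin-point (suc n) f g F.zero h
  rewrite sumFin-cong n {λ x → f (F.suc x)} {λ x → g (F.suc x)} (λ x → h (F.suc x) λ ())
  = xy∙z≈zy∙x (f F.zero) (sumFin n (λ x → g (F.suc x))) (g F.zero)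
sumFin-point (suc n) f g (F.suc k) h = begin
    f₀ + Σf + g k'     ≡⟨ +-assoc f₀ Σf (g k') ⟩
    f₀ + (Σf + g k')   ≡⟨ cong₂ _+_ (h F.zero λ ()) tails ⟩
    g₀ + (Σg + f k')   ≡⟨ +-assoc g₀ Σg (f k') ⟨
    g₀ + Σg + f k'     ∎
  where
  open ≡-Reasoning
  k' = F.suc k
  f₀ = f F.zero
  g₀ = g F.zero
  Σf = sumFin n (λ x → f (F.suc x))
  Σg = sumFin n (λ x → g (F.suc x))
  tails : Σf + g k' ≡ Σg + f k'
  tails = sumFin-point n _ _ k (λ x x≢k → h (F.suc x) (λ eq → x≢k (FP.suc-injective eq)))

ones : ℕ → (n : ℕ) → Fin n → ℕ
ones zero _ _ = 0
ones (suc r) (suc n) F.zero = 1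
ones (suc r) (suc n) (F.suc k) = ones r n k

sumFin-ones : ∀ r n → r ≤ n → sumFin n (ones r n) ≡ r
sumFin-ones zero n _ = sumFin-zeros n
sumFin-ones (suc r) (suc n) (s≤s r≤n) = cong suc (sumFin-ones r n r≤n)

ones≤1 : ∀ r n k → ones r n k ≤ 1
ones≤1 zero n k = z≤n
ones≤1 (suc r) (suc n) F.zero = s≤s z≤n
ones≤1 (suc r) (suc n) (F.suc k) = ones≤1 r n k

at-and-off : ∀ {n} {P : Fin n → Set} k → P k → (∀ x → x ≢ k → P x) → ∀ x → P x
at-and-off k at off x with x F.≟ k
... | yes refl = at
... | no x≢k = off x x≢k

another : ∀ {t} → 2 ≤ t → (j : Fin t) → Σ (Fin t) λ j' → j' ≢ j
another {suc (suc _)} _ F.zero = F.suc F.zero , λ ()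
another {suc (suc _)} _ (F.suc _) = F.zero , λ ()
another {suc zero} (s≤s ()) F.zero

module GameFacts {V : Set} (_≟_ : DecidableEquality V) (Adj : V → V → Set) (r : V) where

  open Pebbling _≟_ Adj r

  move-source : ∀ C u v → u ≢ v → move C u v u ≡ C u ∸ 2
  move-source C u v u≢v with u ≟ u | u ≟ v
  ... | _     | yes u≡v = ⊥-elim (u≢v u≡v)
  ... | yes _ | no _    = refl
  ... | no ¬r | no _    = ⊥-elim (¬r refl)

  move-target : ∀ C u v → u ≢ v → move C u v v ≡ C v + 1
  move-target C u v u≢v with v ≟ u | v ≟ v
  ... | yes v≡u | _     = ⊥-elim (u≢v (sym v≡u))
  ... | no _    | yes _ = refl
  ... | no _    | no ¬r = ⊥-elim (¬r refl)

  move-other : ∀ C u v w → w ≢ u → w ≢ v → move C u v w ≡ C w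
  move-other C u v w w≢u w≢v with w ≟ u | w ≟ v
  ... | yes w≡u | _       = ⊥-elim (w≢u w≡u)
  ... | no _    | yes w≡v = ⊥-elim (w≢v w≡v)
  ... | no _    | no _    = refl

  move-keeps : ∀ C u v w → w ≢ u → C w ≤ move C u v w
  move-keeps C u v w w≢u with w ≟ u | w ≟ v
  ... | yes w≡u | _     = ⊥-elim (w≢u w≡u)
  ... | no _    | yes _ = m≤m+n (C w) 1
  ... | no _    | no _  = ≤-refl

  onto-root : ∀ C u → u ≢ r → MoverWins (move C u r)
  onto-root C u u≢r =
    rootPebbled (≤-trans (m≤n+m 1 (C r)) (≤-reflexive (sym (move-target C u r u≢r))))

  via-neighbour : ∀ C {u} → Legal C u r → u ≢ r → MoverWins C
  via-neighbour C {u} legal u≢r =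
    play u r legal (rootPebbledD (≤-trans (m≤n+m 1 (C r)) (≤-reflexive (sym (move-target C u r u≢r)))))

  mutual
    not-both-win : ∀ {C} → MoverWins C → DefenderWins C → ⊥
    not-both-win (rootPebbled pebbled) (allMoves empty _) = 1+n≰n (≤-trans pebbled (≤-reflexive empty))
    not-both-win (play u v legal m) (allMoves _ d) = not-both-winD m (d u v legal)

    not-both-winD : ∀ {C u v} → MoverWinsD C u v → DefenderWinsD C u v → ⊥
    not-both-winD (rootPebbledD pebbled) (stuck empty _) = 1+n≰n (≤-trans pebbled (≤-reflexive empty))
    not-both-winD (rootPebbledD pebbled) (choose empty _ _ _ _ _) =
      1+n≰n (≤-trans pebbled (≤-reflexive empty))
    not-both-winD (respond (a , b , legal , notBack) _) (stuck _ onlyBack) = notBack (onlyBack a b legal)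
    not-both-winD (respond _ m) (choose _ a b legal notBack d) = not-both-win (m a b legal notBack) d

  eta-from-bounds : ∀ (size : Config → ℕ) N →
    (∀ C → N ≤ size C → MoverWins C) →
    (∀ m → m < N → Σ Config λ C → size C ≡ m × ¬ MoverWins C) →
    EtaIs size N
  eta-from-bounds size N upper lower =
    (λ C eq → upper C (≤-reflexive (sym eq))) ,
    lower ,
    λ defenderWinsLarge → let (C , N<size , dw) = defenderWinsLarge N in
      not-both-win (upper C (<⇒≤ N<size)) dw

module Game {s t : ℕ} (H : SimpleGraph s) where

  open Pebbling (_≟V_ {s} {t}) (GAdj H) root public
  open GameFacts (_≟V_ {s} {t}) (GAdj H) root public

  V : Set
  V = Vtx s t

  Quiet : Config → Set
  Quiet C = C root ≡ 0 × (∀ i → C (sv i) ≤ 1)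

  data FromT (C : Config) : V → V → Set where
    fromT : ∀ j i → 2 ≤ C (tv j) → FromT C (tv j) (sv i)

  quiet-moves : ∀ {C a b} → Quiet C → Legal C a b → FromT C a b
  quiet-moves (empty , _) (r-s i , two) = ⊥-elim (two≰zero empty two)
  quiet-moves (_ , small) (s-r i , two) = ⊥-elim (two≰one (small i) two)
  quiet-moves (_ , small) (s-t i j , two) = ⊥-elim (two≰one (small i) two)
  quiet-moves (_ , small) (s-s i i' _ , two) = ⊥-elim (two≰one (small i) two)
  quiet-moves _ (t-s j i , two) = fromT j i two

  win-from-S : ∀ C i → 2 ≤ C (sv i) → MoverWins C
  win-from-S C i two = via-neighbour C (s-r i , two) (λ ())

  won-or-quiet : ∀ C → MoverWins C ⊎ Quiet C
  won-or-quiet C with C root ≟ 0 | any? (λ i → 2 ≤? C (sv i))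
  ... | no pebbled | _ = inj₁ (rootPebbled (n≢0⇒n>0 pebbled))
  ... | yes _ | yes (i , two) = inj₁ (win-from-S C i two)
  ... | yes empty | no noTwo = inj₂ (empty , λ i → s≤s⁻¹ (≰⇒> (λ two → noTwo (i , two))))

  vacant : ℕ → ℕ
  vacant zero = 1
  vacant (suc _) = 0

  sumS sumT : (ℕ → ℕ) → Config → ℕ
  sumS f C = sumFin s (λ i → f (C (sv i)))
  sumT f C = sumFin t (λ j → f (C (tv j)))

  holes pairs : Config → ℕ
  holes = sumS vacant
  pairs = sumT ⌊_/2⌋

  AllOdd : Config → Set
  AllOdd C = ∀ j → Odd (C (tv j))

  find-hole : ∀ C → 1 ≤ holes C → Σ (Fin s) λ i → C (sv i) ≡ 0
  find-hole C h with sumFin-pos s _ h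
  ... | i , p = i , vacant≥1 p
    where
    vacant≥1 : ∀ {n} → 1 ≤ vacant n → n ≡ 0
    vacant≥1 {zero} _ = refl

  find-pair : ∀ C → 1 ≤ pairs C → Σ (Fin t) λ j → 2 ≤ C (tv j)
  find-pair C h with sumFin-pos t _ h
  ... | j , p = j , half≥1 p

  no-holes : ∀ C → Quiet C → holes C ≡ 0 → ∀ i → C (sv i) ≡ 1
  no-holes C (_ , small) none i = occupied (C (sv i)) (small i)
    (n≤0⇒n≡0 (≤-trans (sumFin-elem s _ i) (≤-reflexive none)))
    where
    occupied : ∀ n → n ≤ 1 → vacant n ≡ 0 → n ≡ 1
    occupied (suc zero) _ _ = refl
    occupied (suc (suc n)) (s≤s ()) _

  sumS-point : ∀ f C C' i → (∀ i' → i' ≢ i → C' (sv i') ≡ C (sv i')) →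
               sumS f C' + f (C (sv i)) ≡ sumS f C + f (C' (sv i))
  sumS-point f C C' i same = sumFin-point s _ _ i (λ x x≢i → cong f (same x x≢i))

  sumT-point : ∀ f C C' j → (∀ j' → j' ≢ j → C' (tv j') ≡ C (tv j')) →
               sumT f C' + f (C (tv j)) ≡ sumT f C + f (C' (tv j))
  sumT-point f C C' j same = sumFin-point t _ _ j (λ x x≢j → cong f (same x x≢j))

  module TtoS (C : Config) (j : Fin t) (i : Fin s) where
    C' : Config
    C' = move C (tv j) (sv i)

    root-same : C' root ≡ C root
    root-same = move-other C (tv j) (sv i) root (λ ()) (λ ())

    target : C' (sv i) ≡ suc (C (sv i))
    target = trans (move-target C (tv j) (sv i) (λ ())) (+-comm _ 1)

    S-same : ∀ i' → i' ≢ i → C' (sv i') ≡ C (sv i')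
    S-same i' i'≢i = move-other C (tv j) (sv i) (sv i') (λ ()) (λ eq → i'≢i (sv-inj eq))

    source : C' (tv j) ≡ C (tv j) ∸ 2
    source = move-source C (tv j) (sv i) (λ ())

    T-same : ∀ j' → j' ≢ j → C' (tv j') ≡ C (tv j')
    T-same j' j'≢j = move-other C (tv j) (sv i) (tv j') (λ eq → j'≢j (tv-inj eq)) (λ ())

    pairs-drop : 2 ≤ C (tv j) → pairs C ≡ suc (pairs C')
    pairs-drop pair = +-cancelʳ-≡ ⌊ C' (tv j) /2⌋ _ _ (begin
      pairs C + ⌊ C' (tv j) /2⌋       ≡⟨ sumT-point ⌊_/2⌋ C C' j T-same ⟨
      pairs C' + ⌊ C (tv j) /2⌋       ≡⟨ cong (pairs C' +_) lose-pair ⟩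
      pairs C' + suc ⌊ C' (tv j) /2⌋  ≡⟨ +-suc (pairs C') _ ⟩
      suc (pairs C') + ⌊ C' (tv j) /2⌋ ∎)
      where
      open ≡-Reasoning
      lose-pair : ⌊ C (tv j) /2⌋ ≡ suc ⌊ C' (tv j) /2⌋
      lose-pair = trans (half-∸2 _ pair) (cong (λ n → suc ⌊ n /2⌋) (sym source))

    holes-fill : C (sv i) ≡ 0 → holes C ≡ suc (holes C')
    holes-fill hole = begin
      holes C                 ≡⟨ +-identityʳ (holes C) ⟨
      holes C + 0             ≡⟨ cong (λ n → holes C + vacant n) (trans target (cong suc hole)) ⟨
      holes C + vacant (C' (sv i)) ≡⟨ sumS-point vacant C C' i S-same ⟨
      holes C' + vacant (C (sv i)) ≡⟨ cong (λ n → holes C' + vacant n) hole ⟩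
      holes C' + 1            ≡⟨ +-comm (holes C') 1 ⟩
      suc (holes C')          ∎
      where open ≡-Reasoning

    holes-full : 1 ≤ C (sv i) → holes C' ≡ holes C
    holes-full full = +-cancelʳ-≡ 0 _ _ (begin
      holes C' + 0                  ≡⟨ cong (holes C' +_) (occupied full) ⟨
      holes C' + vacant (C (sv i))  ≡⟨ sumS-point vacant C C' i S-same ⟩
      holes C + vacant (C' (sv i))  ≡⟨ cong (λ n → holes C + vacant n) target ⟩
      holes C + 0                   ∎)
      where
      open ≡-Reasoning
      occupied : ∀ {n} → 1 ≤ n → vacant n ≡ 0
      occupied {suc _} _ = refl

  module StoT (C : Config) (i : Fin s) (j : Fin t) where
    C' : Config
    C' = move C (sv i) (tv j)

    root-same : C' root ≡ C root
    root-same = move-other C (sv i) (tv j) root (λ ()) (λ ())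

    source : C' (sv i) ≡ C (sv i) ∸ 2
    source = move-source C (sv i) (tv j) (λ ())

    S-same : ∀ i' → i' ≢ i → C' (sv i') ≡ C (sv i')
    S-same i' i'≢i = move-other C (sv i) (tv j) (sv i') (λ eq → i'≢i (sv-inj eq)) (λ ())

    target : C' (tv j) ≡ suc (C (tv j))
    target = trans (move-target C (sv i) (tv j) (λ ())) (+-comm _ 1)

    T-same : ∀ j' → j' ≢ j → C' (tv j') ≡ C (tv j')
    T-same j' j'≢j = move-other C (sv i) (tv j) (tv j') (λ ()) (λ eq → j'≢j (tv-inj eq))

    pairs-change : pairs C' + ⌊ C (tv j) /2⌋ ≡ pairs C + ⌊ suc (C (tv j)) /2⌋
    pairs-change = trans (sumT-point ⌊_/2⌋ C C' j T-same) (cong (λ n → pairs C + ⌊ n /2⌋) target)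

  record Fill (C C' : Config) : Set where
    field
      quiet      : Quiet C'
      holes-dec  : holes C ≡ suc (holes C')
      pairs-dec  : pairs C ≡ suc (pairs C')
      odd-kept   : AllOdd C → AllOdd C'
      empty-kept : ∀ z → C (tv z) ≡ 0 → C' (tv z) ≡ 0

  fill : ∀ {C i j} → Quiet C → C (sv i) ≡ 0 → 2 ≤ C (tv j) → Fill C (move C (tv j) (sv i))
  fill {C} {i} {j} (rootEmpty , small) hole pair = record
    { quiet      = trans root-same rootEmpty ,
                   at-and-off i (≤-reflexive (trans target (cong suc hole)))
                                (λ i' i'≢i → ≤-trans (≤-reflexive (S-same i' i'≢i)) (small i'))
    ; holes-dec  = holes-fill hole
    ; pairs-dec  = pairs-drop pair
    ; odd-kept   = λ odd → at-and-off j (subst Odd (sym source) (odd-∸2 pair (odd j)))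
                                        (λ j' j'≢j → subst Odd (sym (T-same j' j'≢j)) (odd j'))
    ; empty-kept = λ z empty → trans (T-same z (λ { refl → two≰zero empty pair })) empty
    }
    where open TtoS C j i

  -- One bounce: in the quiet position C Mover overloads the full vertex sv i from
  -- tv j and Defender passes a pebble on from sv i to tv j'.
  record Bounce (C : Config) (j' : Fin t) (C'' : Config) : Set where
    field
      quiet       : Quiet C''
      holes-inc   : holes C'' ≡ suc (holes C)
      pairs-upper : pairs C'' ≤ pairs C
      pairs-lower : pairs C ≤ suc (pairs C'')
      pairs-odd   : Odd (C (tv j')) → pairs C'' ≡ pairs C
      pairs-empty : C (tv j') ≡ 0 → suc (pairs C'') ≡ pairs C

  bounce : ∀ {C i j j'} → Quiet C → C (sv i) ≡ 1 → 2 ≤ C (tv j) → j' ≢ j →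
           Bounce C j' (move (move C (tv j) (sv i)) (sv i) (tv j'))
  bounce {C} {i} {j} {j'} (rootEmpty , small) full pair j'≢j = record
    { quiet       = trans D.root-same (trans M.root-same rootEmpty) ,
                    at-and-off i (≤-trans (≤-reflexive (trans D.source (cong (_∸ 2) two))) z≤n)
                      (λ i' i'≢i → ≤-trans (≤-reflexive (trans (D.S-same i' i'≢i) (M.S-same i' i'≢i)))
                                            (small i'))
    ; holes-inc   = trans holes-step (cong suc (M.holes-full (≤-reflexive (sym full))))
    ; pairs-upper = subst (pairs C'' ≤_) (sym drop)
                      (+-cancelʳ-≤ h _ _ (≤-trans (≤-reflexive change)
                        (≤-trans (+-monoʳ-≤ (pairs M.C') (half-suc≤ x)) (≤-reflexive (+-suc _ h)))))
    ; pairs-lower = subst (_≤ suc (pairs C'')) (sym drop)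
                      (s≤s (+-cancelʳ-≤ h _ _
                        (≤-trans (+-monoʳ-≤ (pairs M.C') (⌊n/2⌋-mono (n≤1+n x)))
                        (≤-reflexive (sym change)))))
    ; pairs-odd   = λ odd → trans (+-cancelʳ-≡ h _ _ (trans change
                      (trans (cong (pairs M.C' +_) (half-odd odd)) (+-suc _ h)))) (sym drop)
    ; pairs-empty = λ empty → trans (cong suc (+-cancelʳ-≡ 0 _ _
                      (subst (λ n → pairs C'' + ⌊ n /2⌋ ≡ pairs M.C' + ⌊ suc n /2⌋) empty change)))
                      (sym drop)
    }
    where
    module M = TtoS C j i
    module D = StoT M.C' i j'
    C'' = D.C'
    x = C (tv j')
    h = ⌊ x /2⌋
    two : M.C' (sv i) ≡ 2
    two = trans M.target (cong suc full)
    drop : pairs C ≡ suc (pairs M.C')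
    drop = M.pairs-drop pair
    -- tv j' still holds x pebbles after Mover's move, and receives one more
    change : pairs C'' + h ≡ pairs M.C' + ⌊ suc x /2⌋
    change = subst (λ n → pairs C'' + ⌊ n /2⌋ ≡ pairs M.C' + ⌊ suc n /2⌋)
                   (M.T-same j' j'≢j) D.pairs-change
    -- sv i goes from two pebbles to none
    holes-step : holes C'' ≡ suc (holes M.C')
    holes-step = +-cancelʳ-≡ 0 _ _ (begin
      holes C'' + 0                    ≡⟨ cong (λ n → holes C'' + vacant n) two ⟨
      holes C'' + vacant (M.C' (sv i)) ≡⟨ sumS-point vacant M.C' C'' i D.S-same ⟩
      holes M.C' + vacant (C'' (sv i))
        ≡⟨ cong (λ n → holes M.C' + vacant n) (trans D.source (cong (_∸ 2) two)) ⟩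
      holes M.C' + 1                   ≡⟨ +-comm (holes M.C') 1 ⟩
      suc (holes M.C')                 ≡⟨ +-identityʳ _ ⟨
      suc (holes M.C') + 0             ∎)
      where open ≡-Reasoning

  -- Mover's first kind of round: he fills the hole sv i from tv j.  Defender
  -- must move; moving a pair onto an occupied vertex of S loses at once, so she
  -- has to fill a hole as well.
  fill-round : ∀ {C i j} → Quiet C → C (sv i) ≡ 0 → 2 ≤ C (tv j) →
    1 ≤ pairs (move C (tv j) (sv i)) →
    (∀ C'' → Fill (move C (tv j) (sv i)) C'' → MoverWins C'') → MoverWins C
  fill-round {C} {i} {j} quiet hole pair reply next =
    play (tv j) (sv i) (t-s j i , pair)
      (respond (tv j₀ , sv i , (t-s j₀ i , pair₀) , λ { (() , _) }) answer)
    where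
    C' = move C (tv j) (sv i)
    quiet' : Quiet C'
    quiet' = Fill.quiet (fill quiet hole pair)
    j₀ = proj₁ (find-pair C' reply)
    pair₀ = proj₂ (find-pair C' reply)
    answer : ∀ a b → Legal C' a b → ¬ (a ≡ sv i × b ≡ tv j) → MoverWins (move C' a b)
    answer a b legal _ with quiet-moves {C'} quiet' legal
    ... | fromT j' i' pair' with C' (sv i') in occupancy
    ...   | zero  = next _ (fill {C'} quiet' occupancy pair')
    ...   | suc n = win-from-S _ i' (≤-trans (s≤s (s≤s z≤n))
                      (≤-reflexive (sym (trans (TtoS.target C' j' i') (cong suc occupancy)))))

  -- Mover's second kind of round: with no holes left he overloads sv i from tv j.
  -- Defender's only move that does not lose at once passes a pebble from sv i to
  -- some tv j' other than tv j.
  overload-round : ∀ {C i j} j₀ → Quiet C → holes C ≡ 0 → 2 ≤ C (tv j) → j₀ ≢ j →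
    (∀ j' C'' → j' ≢ j → Bounce C j' C'' → MoverWins C'') → MoverWins C
  overload-round {C} {i} {j} j₀ quiet none pair j₀≢j next =
    play (tv j) (sv i) (t-s j i , pair)
      (respond (sv i , tv j₀ , (s-t i j₀ , ≤-reflexive (sym two)) , λ { (_ , eq) → j₀≢j (tv-inj eq) })
               answer)
    where
    full = no-holes C quiet none
    C' = move C (tv j) (sv i)
    open TtoS C j i using (target; S-same; root-same)
    two : C' (sv i) ≡ 2
    two = trans target (cong suc (full i))
    one : ∀ i' → i' ≢ i → C' (sv i') ≡ 1
    one i' i'≢i = trans (S-same i' i'≢i) (full i')
    only-i : ∀ i' → 2 ≤ C' (sv i') → i' ≡ i
    only-i i' two' = decide (i' F.≟ i)
      where
      decide : Dec (i' ≡ i) → i' ≡ i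
      decide (yes i'≡i) = i'≡i
      decide (no i'≢i) = ⊥-elim (two≰one (≤-reflexive (one i' i'≢i)) two')
    answer : ∀ a b → Legal C' a b → ¬ (a ≡ sv i × b ≡ tv j) → MoverWins (move C' a b)
    answer .root .(sv i') (r-s i' , two') _ =
      ⊥-elim (two≰zero (trans root-same (proj₁ quiet)) two')
    answer .(sv i') .root (s-r i' , _) _ = onto-root C' (sv i') (λ ())
    answer .(tv j') .(sv i') (t-s j' i' , _) _ =
      win-from-S _ i (≤-trans (≤-reflexive (sym two)) (move-keeps C' (tv j') (sv i') (sv i) (λ ())))
    answer .(sv i') .(tv j') (s-t i' j' , two') notBack with only-i i' two'
    ... | refl with j' F.≟ j
    ...   | yes refl = ⊥-elim (notBack (refl , refl))
    ...   | no j'≢j = next j' _ j'≢j (bounce quiet (full i) pair j'≢j)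
    answer .(sv i') .(sv i'') (s-s i' i'' edge , two') _ with only-i i' two'
    ... | refl = win-from-S _ i'' (≤-reflexive (sym (trans (move-target C' (sv i) (sv i'') i≢i'')
                   (cong (_+ 1) (one i'' (λ eq → i≢i'' (cong sv (sym eq))))))))
      where
      i≢i'' : sv {s} {t} i ≢ sv i''
      i≢i'' eq = SimpleGraph.irrefl H (subst (SimpleGraph.E H i) (sym (sv-inj eq)) edge)

  fill-twice : ∀ {C C' C''} → Fill C C' → Fill C' C'' →
               holes C ≡ 2 + holes C'' × pairs C ≡ 2 + pairs C''
  fill-twice f g = trans (Fill.holes-dec f) (cong suc (Fill.holes-dec g)) ,
                   trans (Fill.pairs-dec f) (cong suc (Fill.pairs-dec g))

  onS onT : Config → ℕ
  onS = sumS (λ n → n)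
  onT = sumT (λ n → n)

  size-quiet : ∀ C → Quiet C → size C ≡ onS C + onT C
  size-quiet C (empty , _) = cong (λ r → r + onS C + onT C) empty

  onS+holes : ∀ C → Quiet C → onS C + holes C ≡ s
  onS+holes C (_ , small) = begin
    onS C + holes C                          ≡⟨ sumFin-+ s _ _ ⟨
    sumFin s (λ i → C (sv i) + vacant (C (sv i))) ≡⟨ sumFin-cong s (λ i → one (small i)) ⟩
    sumFin s (λ _ → 1)                       ≡⟨ sumFin-const s 1 ⟩
    s * 1                                    ≡⟨ *-identityʳ s ⟩
    s                                        ∎
    where
    open ≡-Reasoning
    one : ∀ {n} → n ≤ 1 → n + vacant n ≡ 1
    one z≤n = refl
    one (s≤s z≤n) = refl

  private
    odd-ceiling : ∀ C → sumT (λ n → suc (⌊ n /2⌋ + ⌊ n /2⌋)) C ≡ pairs C + pairs C + t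
    odd-ceiling C = begin
      sumT (λ n → suc (⌊ n /2⌋ + ⌊ n /2⌋)) C          ≡⟨ sumFin-cong t (λ j → +-comm 1 _) ⟩
      sumFin t (λ j → (⌊ C (tv j) /2⌋ + ⌊ C (tv j) /2⌋) + 1) ≡⟨ sumFin-+ t _ _ ⟩
      sumFin t (λ j → ⌊ C (tv j) /2⌋ + ⌊ C (tv j) /2⌋) + sumFin t (λ _ → 1)
        ≡⟨ cong₂ _+_ (sumFin-+ t _ _) (trans (sumFin-const t 1) (*-identityʳ t)) ⟩
      pairs C + pairs C + t                             ∎
      where open ≡-Reasoning

  onT-bound : ∀ C → onT C ≤ pairs C + pairs C + t
  onT-bound C = ≤-trans (sumFin-mono t (λ j → ≤-double-half (C (tv j)))) (≤-reflexive (odd-ceiling C))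

  onT-tight : ∀ C → onT C ≡ pairs C + pairs C + t → AllOdd C
  onT-tight C tight j = double-half-odd (C (tv j))
    (sumFin-tight t (λ j → ≤-double-half (C (tv j))) (trans tight (sym (odd-ceiling C))) j)

  -- Mover's strategy.  He needs a vertex i₀ of S to overload and |T| ≥ 2, so
  -- that Defender always has a vertex of T to bounce to.
  module Mover (i₀ : Fin s) (t≥2 : 2 ≤ t) where

    -- An odd number of holes and more pairs than holes: Mover keeps filling
    -- holes, and after he fills the last one Defender has no safe move.
    -- (Induction on a bound n for the number of holes.)
    win-odd : ∀ n C → holes C ≤ n → Quiet C → Odd (holes C) → suc (holes C) ≤ pairs C →
              MoverWins C
    win-odd zero C bound _ odd _ = ⊥-elim (1+n≰n (≤-trans (odd⇒≥1 odd) bound))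
    win-odd (suc n) C bound quiet odd enough =
      fill-round quiet hole pair reply λ C'' g → continue C'' (fill-twice first g) (Fill.quiet g)
      where
      i = proj₁ (find-hole C (odd⇒≥1 odd))
      hole = proj₂ (find-hole C (odd⇒≥1 odd))
      j = proj₁ (find-pair C (≤-trans (s≤s z≤n) enough))
      pair = proj₂ (find-pair C (≤-trans (s≤s z≤n) enough))
      first = fill quiet hole pair
      reply : 1 ≤ pairs (move C (tv j) (sv i))
      reply = s≤s⁻¹ (subst (2 ≤_) (Fill.pairs-dec first) (≤-trans (s≤s (odd⇒≥1 odd)) enough))
      continue : ∀ C'' → holes C ≡ 2 + holes C'' × pairs C ≡ 2 + pairs C'' → Quiet C'' →
                 MoverWins C''
      continue C'' (h , p) quiet'' = win-odd n C''
        (s≤s⁻¹ (≤-trans (n≤1+n _) (subst (_≤ suc n) h bound)))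
        quiet''
        (even-pred₂ (subst Odd h odd))
        (s≤s⁻¹ (s≤s⁻¹ (subst₂ (λ a b → suc a ≤ b) h p enough)))

    EvenGoal : Config → Set
    EvenGoal C = 3 + holes C ≤ pairs C ⊎ (AllOdd C × 2 + holes C ≤ pairs C)

    even-goal-pairs : ∀ C → EvenGoal C → 2 ≤ pairs C
    even-goal-pairs C (inj₁ enough) = ≤-trans (m≤m+n 2 (suc (holes C))) enough
    even-goal-pairs C (inj₂ (_ , enough)) = ≤-trans (m≤m+n 2 (holes C)) enough

    -- No holes: Mover overloads i₀; whatever vertex tv j' Defender bounces to,
    -- one hole and still two pairs remain, so the odd strategy applies.
    win-no-holes : ∀ C → Quiet C → holes C ≡ 0 → EvenGoal C → MoverWins C
    win-no-holes C quiet none goal =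
      overload-round {i = i₀} (proj₁ (another t≥2 j)) quiet none pair (proj₂ (another t≥2 j)) next
      where
      j = proj₁ (find-pair C (≤-trans (s≤s z≤n) (even-goal-pairs C goal)))
      pair = proj₂ (find-pair C (≤-trans (s≤s z≤n) (even-goal-pairs C goal)))
      next : ∀ j' C'' → j' ≢ j → Bounce C j' C'' → MoverWins C''
      next j' C'' _ b = win-odd (holes C'') C'' ≤-refl (Bounce.quiet b)
        (subst Odd (sym one) (ev2 ev0))
        (subst (_≤ pairs C'') (cong suc (sym one)) (two-pairs goal))
        where
        one : holes C'' ≡ 1
        one = trans (Bounce.holes-inc b) (cong suc none)
        two-pairs : EvenGoal C → 2 ≤ pairs C''
        two-pairs (inj₁ enough) =
          s≤s⁻¹ (≤-trans (subst (λ h → 3 + h ≤ pairs C) none enough) (Bounce.pairs-lower b))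
        two-pairs (inj₂ (allOdd , enough)) =
          subst (2 ≤_) (sym (Bounce.pairs-odd b (allOdd j'))) (subst (λ h → 2 + h ≤ pairs C) none enough)

    -- An even number of holes: Mover fills holes two at a time (one by each
    -- player) until none are left, then overloads.
    win-even : ∀ n C → holes C ≤ n → Quiet C → Even (holes C) → EvenGoal C → MoverWins C
    win-even n C bound quiet even goal with holes C ≟ 0
    ... | yes none = win-no-holes C quiet none goal
    win-even zero C bound quiet even goal | no some = ⊥-elim (some (n≤0⇒n≡0 bound))
    win-even (suc n) C bound quiet even goal | no some =
      fill-round quiet hole pair reply λ C'' g → continue C'' (fill-twice first g) g
      where
      i = proj₁ (find-hole C (n≢0⇒n>0 some))
      hole = proj₂ (find-hole C (n≢0⇒n>0 some))
      j = proj₁ (find-pair C (≤-trans (s≤s z≤n) (even-goal-pairs C goal)))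
      pair = proj₂ (find-pair C (≤-trans (s≤s z≤n) (even-goal-pairs C goal)))
      first = fill quiet hole pair
      reply : 1 ≤ pairs (move C (tv j) (sv i))
      reply = s≤s⁻¹ (subst (2 ≤_) (Fill.pairs-dec first) (even-goal-pairs C goal))
      continue : ∀ C'' → holes C ≡ 2 + holes C'' × pairs C ≡ 2 + pairs C'' →
                 Fill (move C (tv j) (sv i)) C'' → MoverWins C''
      continue C'' (hh , pp) g = win-even n C''
        (s≤s⁻¹ (≤-trans (n≤1+n _) (subst (_≤ suc n) hh bound)))
        (Fill.quiet g)
        (even-pred₂ (subst Even hh even))
        (goal'' goal)
        where
        goal'' : EvenGoal C → EvenGoal C''
        goal'' (inj₁ enough) = inj₁ (s≤s⁻¹ (s≤s⁻¹ (subst₂ (λ a b → 3 + a ≤ b) hh pp enough)))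
        goal'' (inj₂ (allOdd , enough)) =
          inj₂ (Fill.odd-kept g (Fill.odd-kept first allOdd) ,
                s≤s⁻¹ (s≤s⁻¹ (subst₂ (λ a b → 2 + a ≤ b) hh pp enough)))

    win-large : ∀ c → 3 ≤ c → Even (s + c) → ∀ C → t + 2 * s + c ≤ size C → MoverWins C
    win-large c c≥3 parity C big with won-or-quiet C
    ... | inj₁ won = won
    ... | inj₂ quiet = by-parity (even-or-odd (holes C))
      where
      stones+holes = onS+holes C quiet
      δ = proj₁ (m≤n⇒∃[o]m+o≡n (onT-bound C))
      slack : onT C + δ ≡ pairs C + pairs C + t
      slack = proj₂ (m≤n⇒∃[o]m+o≡n (onT-bound C))
      y≥3 : 3 ≤ onS C + c
      y≥3 = ≤-trans c≥3 (m≤n+m c (onS C))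
      count : δ + (holes C + holes C) + (onS C + c) ≤ pairs C + pairs C
      count = budget t c (onS C) (holes C) (onT C) (pairs C) δ stones+holes slack
                (subst (t + 2 * s + c ≤_) (size-quiet C quiet) big)
      goal : 3 + holes C ≤ pairs C ⊎ (δ ≡ 0 × 2 + holes C ≤ pairs C) → EvenGoal C
      goal (inj₁ enough) = inj₁ enough
      goal (inj₂ (noSlack , enough)) =
        inj₂ (onT-tight C (trans (sym (trans (cong (onT C +_) noSlack) (+-identityʳ _))) slack) , enough)
      by-parity : Even (holes C) ⊎ Odd (holes C) → MoverWins C
      by-parity (inj₂ odd) = win-odd (holes C) C ≤-refl quiet odd
        (odd-budget δ (holes C) (onS C + c) (pairs C) y≥3 count)
      by-parity (inj₁ even) = win-even (holes C) C ≤-refl quiet even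
        (goal (even-budget δ (holes C) (onS C + c) (pairs C) (even≥3 y-even y≥3) count))
        where
        y-even : Even (onS C + c)
        y-even = even-cancelʳ (onS C + c) even (subst Even
          (trans (cong (_+ c) (sym stones+holes)) (xy∙z≈xz∙y (onS C) (holes C) c)) parity)

  -- A safe position has few pairs compared to its holes;
  -- one extra pair is tolerated when e is even and a vertex z of T is empty,
  -- because Defender can then bounce to z without creating a pair.
  module Defender (t≥2 : 2 ≤ t) where

    data Safe (C : Config) : Set where
      safe-odd   : Odd (holes C) → pairs C ≤ holes C → Safe C
      safe-even  : Even (holes C) → pairs C ≤ suc (holes C) → Safe C
      safe-empty : Even (holes C) → pairs C ≤ 2 + holes C → (z : Fin t) → C (tv z) ≡ 0 → Safe C

    hole-left : ∀ {C C'} → Safe C → Fill C C' → 1 ≤ pairs C' → 1 ≤ holes C'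
    hole-left (safe-odd _ few) f reply =
      s≤s⁻¹ (≤-trans (s≤s reply) (subst₂ _≤_ (Fill.pairs-dec f) (Fill.holes-dec f) few))
    hole-left (safe-even even _) f _ = odd⇒≥1 (subst Even (Fill.holes-dec f) even)
    hole-left (safe-empty even _ _ _) f _ = odd⇒≥1 (subst Even (Fill.holes-dec f) even)

    safe-fill-twice : ∀ {C C' C''} → Safe C → Fill C C' → Fill C' C'' → Safe C''
    safe-fill-twice {C} {C'' = C''} safe f g = safe'' safe
      where
      hh = proj₁ (fill-twice f g)
      pp = proj₂ (fill-twice f g)
      safe'' : Safe C → Safe C''
      safe'' (safe-odd odd few) =
        safe-odd (even-pred₂ (subst Odd hh odd)) (s≤s⁻¹ (s≤s⁻¹ (subst₂ _≤_ pp hh few)))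
      safe'' (safe-even even few) =
        safe-even (even-pred₂ (subst Even hh even))
          (s≤s⁻¹ (s≤s⁻¹ (subst₂ (λ a b → a ≤ suc b) pp hh few)))
      safe'' (safe-empty even few z empty) =
        safe-empty (even-pred₂ (subst Even hh even))
          (s≤s⁻¹ (s≤s⁻¹ (subst₂ (λ a b → a ≤ 2 + b) pp hh few)))
          z (Fill.empty-kept g z (Fill.empty-kept f z empty))

    -- When Mover overloads a full vertex from tv j, Defender bounces to a vertex
    -- tv j' ≠ tv j that keeps the position safe: an empty one if there is one
    -- on record, any other one otherwise.
    bounce-target : ∀ {C j} → Safe C → 2 ≤ C (tv j) →
                    Σ (Fin t) λ j' → j' ≢ j × (∀ C'' → Bounce C j' C'' → Safe C'')
    bounce-target {C} {j} (safe-odd odd few) _ =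
      proj₁ (another t≥2 j) , proj₂ (another t≥2 j) , λ C'' b →
        let more = sym (Bounce.holes-inc b) in
        safe-even (subst Even more odd)
          (subst (λ h → pairs C'' ≤ suc h) more
            (≤-trans (Bounce.pairs-upper b) (≤-trans few (≤-trans (n≤1+n _) (n≤1+n _)))))
    bounce-target {C} {j} (safe-even even few) _ =
      proj₁ (another t≥2 j) , proj₂ (another t≥2 j) , λ C'' b →
        let more = sym (Bounce.holes-inc b) in
        safe-odd (subst Odd more (ev2 even))
          (subst (pairs C'' ≤_) more (≤-trans (Bounce.pairs-upper b) few))
    bounce-target {C} {j} (safe-empty even few z empty) pair =
      z , z≢j , λ C'' b →
        let more = sym (Bounce.holes-inc b) in
        safe-odd (subst Odd more (ev2 even))
          (subst (pairs C'' ≤_) more (s≤s⁻¹ (≤-trans (≤-reflexive (Bounce.pairs-empty b empty)) few)))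
      where
      z≢j : z ≢ j
      z≢j refl = two≰zero empty pair

    -- Mover cannot win from a quiet safe position: each of his moves fills a
    -- hole or overloads a full vertex, and Defender answers with a fill or a
    -- bounce that restores a quiet safe position.
    mutual
      defend : ∀ C → Quiet C → Safe C → ¬ MoverWins C
      defend C (rootEmpty , _) _ (rootPebbled pebbled) = 1+n≰n (≤-trans pebbled (≤-reflexive rootEmpty))
      defend C quiet safe (play a b legal m) with quiet-moves {C} quiet legal
      ... | fromT j i pair = defend-round C j i quiet safe pair m

      defend-round : ∀ C j i → Quiet C → Safe C → 2 ≤ C (tv j) →
                     ¬ MoverWinsD (move C (tv j) (sv i)) (tv j) (sv i)
      defend-round C j i (rootEmpty , _) _ _ (rootPebbledD pebbled) =
        1+n≰n (≤-trans pebbled (≤-reflexive (trans (TtoS.root-same C j i) rootEmpty)))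
      defend-round C j i quiet safe pair (respond reply wins) = by-occupancy (≤1-cases (proj₂ quiet i))
        where
        C' = move C (tv j) (sv i)
        by-occupancy : C (sv i) ≡ 0 ⊎ C (sv i) ≡ 1 → ⊥
        by-occupancy (inj₁ hole) =
          defend C'' (Fill.quiet g) (safe-fill-twice safe f g)
            (wins (tv j') (sv i') (t-s j' i' , pair') λ { (() , _) })
          where
          f = fill quiet hole pair
          pair-of-reply : (Σ V λ a → Σ V λ b → Legal C' a b × ¬ (a ≡ sv i × b ≡ tv j)) →
                          Σ (Fin t) λ j' → 2 ≤ C' (tv j')
          pair-of-reply (a , b , legal , _) with quiet-moves {C'} (Fill.quiet f) legal
          ... | fromT j' _ pair' = j' , pair'
          j' = proj₁ (pair-of-reply reply)
          pair' = proj₂ (pair-of-reply reply)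
          hole' = find-hole C' (hole-left safe f (≤-trans (≥2⇒half≥1 pair') (sumFin-elem t _ j')))
          i' = proj₁ hole'
          C'' = move C' (tv j') (sv i')
          g = fill {C'} (Fill.quiet f) (proj₂ hole') pair'
        by-occupancy (inj₂ full) =
          defend C'' (Bounce.quiet b) (keep C'' b)
            (wins (sv i) (tv j') (s-t i j' , ≤-reflexive (sym two)) λ { (_ , eq) → j'≢j (tv-inj eq) })
          where
          target = bounce-target safe pair
          j' = proj₁ target
          j'≢j = proj₁ (proj₂ target)
          keep = proj₂ (proj₂ target)
          C'' = move C' (sv i) (tv j')
          b = bounce quiet full pair j'≢j
          two : C' (sv i) ≡ 2
          two = trans (TtoS.target C j i) (cong suc full)


module Extremal (s' t' : ℕ) (H : SimpleGraph (suc s')) where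
  open Game {suc s'} {suc (suc t')} H
  open Defender (s≤s (s≤s z≤n))

  spread : ℕ → ℕ → ℕ → Config
  spread σ a r root = 0
  spread σ a r (sv F.zero) = σ
  spread σ a r (sv (F.suc _)) = 0
  spread σ a r (tv F.zero) = 0
  spread σ a r (tv (F.suc F.zero)) = a
  spread σ a r (tv (F.suc (F.suc k))) = ones r t' k

  spread-size : ∀ σ a r → r ≤ t' → size (spread σ a r) ≡ σ + (a + r)
  spread-size σ a r r≤t' =
    cong₂ _+_ (trans (cong (σ +_) (sumFin-zeros s')) (+-identityʳ σ))
              (cong (a +_) (sumFin-ones r t' r≤t'))

  spread-holes : ∀ σ a r → holes (spread σ a r) ≡ vacant σ + s'
  spread-holes σ a r = cong (vacant σ +_) (trans (sumFin-const s' 1) (*-identityʳ s'))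

  spread-pairs : ∀ σ a r → pairs (spread σ a r) ≡ ⌊ a /2⌋
  spread-pairs σ a r = trans (cong (⌊ a /2⌋ +_) (trans (sumFin-cong t' no-pairs) (sumFin-zeros t')))
                             (+-identityʳ _)
    where
    no-pairs : ∀ k → ⌊ ones r t' k /2⌋ ≡ 0
    no-pairs k = n≤0⇒n≡0 (half-≤ 0 (ones≤1 r t' k))

  spread-quiet : ∀ σ a r → σ ≤ 1 → Quiet (spread σ a r)
  spread-quiet σ a r σ≤1 = refl , λ { F.zero → σ≤1 ; (F.suc _) → z≤n }

  -- With an even number of holes e, up to 2e + 5 pebbles on the second
  -- vertex of T are still safe, because the first vertex of T is empty.
  spread-safe : ∀ σ a r → σ ≤ 1 → Even (vacant σ + s') →
                a ≤ suc ((2 + (vacant σ + s')) + (2 + (vacant σ + s'))) → ¬ MoverWins (spread σ a r)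
  spread-safe σ a r σ≤1 even few = defend _ (spread-quiet σ a r σ≤1)
    (safe-empty (subst Even (sym (spread-holes σ a r)) even)
      (subst₂ (λ p e → p ≤ 2 + e) (sym (spread-pairs σ a r)) (sym (spread-holes σ a r))
              (half-≤ _ few))
      F.zero refl)

  -- For even s: every size below t + 2s + 4 (S empty, e = s holes).
  below-even : Even (suc s') → ∀ m → m < suc (suc t') + 2 * suc s' + 4 →
               Σ Config λ C → size C ≡ m × ¬ MoverWins C
  below-even even m m<N with split m (suc ((2 + suc s') + (2 + suc s'))) t'
                               (s≤s⁻¹ (subst (suc m ≤_) (bound t' s') m<N))
    where
    bound : ∀ t' s' → suc (suc t') + 2 * suc s' + 4 ≡ suc (t' + suc ((2 + suc s') + (2 + suc s')))
    bound = solve-∀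
  ... | a , r , r≤t' , a+r≡m , few =
    spread 0 a r , trans (spread-size 0 a r r≤t') a+r≡m , spread-safe 0 a r z≤n even few

  -- For odd s: the empty configuration, and every size from 1 to t + 2s + 2
  -- with one pebble on S (e = s - 1 holes).
  below-odd : ¬ Even (suc s') → ∀ m → m < suc (suc t') + 2 * suc s' + 3 →
              Σ Config λ C → size C ≡ m × ¬ MoverWins C
  below-odd odd zero _ = spread 0 0 0 , spread-size 0 0 0 z≤n ,
    defend (spread 0 0 0) (spread-quiet 0 0 0 z≤n)
      (safe-odd (subst Odd (sym (spread-holes 0 0 0)) (¬even⇒odd odd))
                (≤-trans (≤-reflexive (spread-pairs 0 0 0)) z≤n))
  below-odd odd (suc m) m<N with split m (suc ((2 + s') + (2 + s'))) t'
                                   (s≤s⁻¹ (s≤s⁻¹ (subst (suc (suc m) ≤_) (bound t' s') m<N)))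
    where
    bound : ∀ t' s' → suc (suc t') + 2 * suc s' + 3 ≡ suc (suc (t' + suc ((2 + s') + (2 + s'))))
    bound = solve-∀
  ... | a , r , r≤t' , a+r≡m , few =
    spread 1 a r , trans (spread-size 1 a r r≤t') (cong suc a+r≡m) ,
    spread-safe 1 a r ≤-refl (even-pred₂ (¬even⇒odd odd)) few

theorem3p21 : (s t : ℕ) → 1 ≤ s → 2 ≤ t → (H : SimpleGraph s) →
    (Even s → EtaG {s} {t} H (t + 2 * s + 4)) × (¬ Even s → EtaG {s} {t} H (t + 2 * s + 3))
theorem3p21 (suc s') (suc (suc t')) _ t≥2 H =
  (λ even → eta-from-bounds size _
     (win-large 4 (s≤s (s≤s (s≤s z≤n))) (even-+ even (ev2 (ev2 ev0)))) (below-even even)) ,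
  (λ odd → eta-from-bounds size _
     (win-large 3 ≤-refl (subst Even (sym (+-suc (suc s') 2)) (even-+ (¬even⇒odd odd) (ev2 ev0))))
     (below-odd odd))
  where
  open Game {suc s'} {suc (suc t')} H
  open Mover F.zero t≥2
  open Extremal s' t' H
theorem3p21 zero _ () _ _
theorem3p21 (suc _) zero _ () _
theorem3p21 (suc _) (suc zero) _ (s≤s ()) _
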